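{- Let $N\ge 1$. The maximum of $S(G)$ over all forests $G$ with exactly $N$ edges equals $1$ if $N=1$ and equals $2N-2$ if $N\ge 2$.
   Context: All graphs are finite and simple. For a graph $G$ with edge set $E(G)$, the specialty of $G$ is $S(G)=\sum_{uv\in E(G)}\min(\deg u,\deg v)$. -}

module Defs where

open import Data.Nat using (ℕ; zero; suc; _+_; _*_; _∸_; _⊓_; _<_)
open import Data.Bool using (Bool; true; false; if_then_else_)
open import Data.Fin using (Fin; zero; suc; toℕ; inject₁; fromℕ)
open import Data.List using (List; map; allFin)
open import Data.Nat.ListAction using (sum)
open import Data.Product using (Σ; _×_; ∃)
open import Relation.Binary.PropositionalEquality using (_≡_)
open import Relation.Nullary using (¬_)
open import Relation.Nullary.Decidable using (⌊_⌋)
open import Function.Definitions using (Injective)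
open import Data.Nat.Properties using (_<?_)

record Graph : Set where
  field
    n     : ℕ
    adj   : Fin n → Fin n → Bool
    sym   : ∀ u v → adj u v ≡ adj v u
    irrefl : ∀ v → adj v v ≡ false
open Graph public

b2n : Bool → ℕ
b2n true  = 1
b2n false = 0

Σfin : (k : ℕ) → (Fin k → ℕ) → ℕ
Σfin k f = sum (map f (allFin k))

deg : (G : Graph) → Fin (n G) → ℕ
deg G u = Σfin (n G) (λ v → b2n (adj G u v))

Σedges : (G : Graph) → (Fin (n G) → Fin (n G) → ℕ) → ℕ
Σedges G w = Σfin (n G) (λ u → Σfin (n G) (λ v →
  if ⌊ toℕ u <? toℕ v ⌋ then (if adj G u v then w u v else 0) else 0))

edgeCount : Graph → ℕ
edgeCount G = Σedges G (λ _ _ → 1)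

specialty : Graph → ℕ
specialty G = Σedges G (λ u v → deg G u ⊓ deg G v)

record Cycle (G : Graph) : Set where
  field
    k      : ℕ
    f      : Fin (3 + k) → Fin (n G)
    inj    : Injective _≡_ _≡_ f
    step   : ∀ (i : Fin (2 + k)) → adj G (f (inject₁ i)) (f (suc i)) ≡ true
    close  : adj G (f (fromℕ (2 + k))) (f zero) ≡ true

Forest : Graph → Set
Forest G = ¬ Cycle G

maxSpecialty : ℕ → ℕ
maxSpecialty 1 = 1
maxSpecialty N = 2 * N ∸ 2

module Submission where

-- A forest with N edges and maximum degree Δ has S ≤ Δ·N, as every term min(deg u, deg v) is at
-- most Δ. Moreover S + deg r ≤ 2N for every vertex r: removing a leaf u ≠ r deletes one edge,
-- contributing at most deg u, and isolates u, so by induction S is at most the sum of the (original)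
-- degrees of the non-isolated vertices other than r, which is 2N − deg r. For r of maximum degree
-- this gives S ≤ min(ΔN, 2N − Δ) ≤ 2N − 2 when N ≥ 2. The path with N edges attains the bound.

open import Defs renaming (sym to adj-sym; irrefl to adj-irrefl)
open import Data.Nat using (ℕ; zero; suc; _+_; _*_; _∸_; _⊓_; _≤_; _<_; _≥_; z≤n; s≤s; z<s)
open import Data.Nat.Properties
open import Data.Bool using (Bool; true; false; if_then_else_; _∨_)
open import Data.Bool.Properties as Bool using (¬-not)
open import Data.Fin as Fin using (Fin; zero; suc; toℕ; inject₁; fromℕ)
open import Data.Fin.Relation.Unary.Top using (view; ‵fromℕ; ‵inject₁)
open import Data.Fin.Properties as Finₚ using (toℕ-injective; toℕ<n; toℕ-inject₁; toℕ-fromℕ; pigeonhole; any?)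
open import Data.List using (tabulate)
open import Data.List.Properties using (map-tabulate)
import Data.Nat.ListAction as List
open import Data.Product using (Σ; _×_; _,_; ∃; ∃₂)
open import Data.Sum using (_⊎_; inj₁; inj₂)
open import Data.Empty using (⊥-elim)
open import Relation.Binary.PropositionalEquality
open import Relation.Nullary using (Dec; yes; no; does; contradiction)
open import Relation.Nullary.Decidable using (⌊_⌋; dec-true; dec-false; _×-dec_; ¬?)
open import Function using (_∘_; id)
open import Induction.WellFounded using (Acc; acc)
open import Data.Nat.Induction using (<-wellFounded)
open import Data.Nat.Tactic.RingSolver using (solve-∀)
open import Algebra.Properties.Semiring.Sum +-*-semiring
  using (sum; sum-syntax; sum-cong-≗; ∑-distrib-+; ∑-comm; sum-replicate-zero; sum-init-last; *-distribˡ-sum)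

Σfin≡sum : ∀ m (f : Fin m → ℕ) → Σfin m f ≡ sum f
Σfin≡sum m f = trans (cong List.sum (map-tabulate id f)) (sum-tabulate m f)
  where
  sum-tabulate : ∀ m (f : Fin m → ℕ) → List.sum (tabulate f) ≡ sum f
  sum-tabulate zero    f = refl
  sum-tabulate (suc m) f = cong (f zero +_) (sum-tabulate m (f ∘ suc))

sum-mono-≤ : ∀ {m} {f g : Fin m → ℕ} → (∀ i → f i ≤ g i) → sum f ≤ sum g
sum-mono-≤ {zero}  f≤g = z≤n
sum-mono-≤ {suc m} f≤g = +-mono-≤ (f≤g zero) (sum-mono-≤ (f≤g ∘ suc))

sum-mono-< : ∀ {m} {f g : Fin m → ℕ} → (∀ i → f i ≤ g i) → ∀ i → f i < g i → sum f < sum g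
sum-mono-< f≤g zero    fi<gi = +-mono-<-≤ fi<gi (sum-mono-≤ (f≤g ∘ suc))
sum-mono-< f≤g (suc i) fi<gi = +-mono-≤-< (f≤g zero) (sum-mono-< (f≤g ∘ suc) i fi<gi)

term≤sum : ∀ {m} (f : Fin m → ℕ) i → f i ≤ sum f
term≤sum f zero    = m≤m+n (f zero) _
term≤sum f (suc i) = ≤-trans (term≤sum (f ∘ suc) i) (m≤n+m _ (f zero))

sum-point : ∀ {m} (a : Fin m) (c : ℕ) → ∑[ x < m ] (if does (x Finₚ.≟ a) then c else 0) ≡ c
sum-point {suc m} zero    c = trans (cong (c +_) (sum-replicate-zero m)) (+-identityʳ c)
sum-point {suc m} (suc a) c = sum-point a c

sum-zero : ∀ {m} {f : Fin m → ℕ} → (∀ i → f i ≡ 0) → sum f ≡ 0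
sum-zero {m} f≡0 = trans (sum-cong-≗ f≡0) (sum-replicate-zero m)

sum-positive : ∀ {m} (f : Fin m → ℕ) → 0 < sum f → ∃ λ i → 0 < f i
sum-positive {suc m} f 0<sum with f zero in eq
... | suc _ = zero , subst (0 <_) (sym eq) z<s
... | zero  = let i , 0<fi = sum-positive (f ∘ suc) 0<sum in suc i , 0<fi

maximum-attained : ∀ {m} (f : Fin m → ℕ) → Fin m → ∃ λ i → ∀ j → f j ≤ f i
maximum-attained {suc zero}    f _ = zero , λ { zero → ≤-refl }
maximum-attained {suc (suc m)} f _ with maximum-attained (f ∘ suc) zero
... | i , max with ≤-total (f zero) (f (suc i))
...   | inj₁ f0≤ = suc i , λ { zero → f0≤ ; (suc j) → max j }
...   | inj₂ ≥f0 = zero  , λ { zero → ≤-refl ; (suc j) → ≤-trans (max j) ≥f0 }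

sum-const : ∀ m c → ∑[ i < m ] c ≡ m * c
sum-const zero    c = refl
sum-const (suc m) c = cong (c +_) (sum-const m c)

sum-toℕ-point : ∀ m a (g : ℕ → ℕ) → ∑[ y < m ] (if does (a ≟ toℕ y) then g (toℕ y) else 0) ≡ (if does (a <? m) then g a else 0)
sum-toℕ-point zero    a       g = refl
sum-toℕ-point (suc m) zero    g = trans (cong (g 0 +_) (sum-replicate-zero m)) (+-identityʳ (g 0))
sum-toℕ-point (suc m) (suc a) g = sum-toℕ-point m a (g ∘ suc)

sum-toℕ-below : ∀ N (F : ℕ → ℕ) → ∑[ x < suc N ] (if does (toℕ x <? N) then F (toℕ x) else 0) ≡ ∑[ i < N ] F (toℕ i)
sum-toℕ-below zero    F = refl
sum-toℕ-below (suc N) F = cong (F 0 +_) (sum-toℕ-below N (F ∘ suc))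

does-≟-sym : ∀ a b → does (a ≟ b) ≡ does (b ≟ a)
does-≟-sym zero    zero    = refl
does-≟-sym zero    (suc b) = refl
does-≟-sym (suc a) zero    = refl
does-≟-sym (suc a) (suc b) = does-≟-sym a b

∑₂ : ∀ {m} → (Fin m → Fin m → ℕ) → ℕ
∑₂ {m} f = ∑[ x < m ] ∑[ y < m ] f x y

∑₂-distrib-+ : ∀ {m} (f g : Fin m → Fin m → ℕ) → ∑₂ (λ x y → f x y + g x y) ≡ ∑₂ f + ∑₂ g
∑₂-distrib-+ {m} f g = trans (sum-cong-≗ λ x → ∑-distrib-+ (f x) (g x))
  (∑-distrib-+ (λ x → ∑[ y < m ] f x y) (λ x → ∑[ y < m ] g x y))

pointAt : ∀ {m} → Fin m → Fin m → ℕ → Fin m → Fin m → ℕ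
pointAt a b c x y = if does (x Finₚ.≟ a) then (if does (y Finₚ.≟ b) then c else 0) else 0

pointAt-at : ∀ {m} (a b : Fin m) c → pointAt a b c a b ≡ c
pointAt-at a b c rewrite dec-true (a Finₚ.≟ a) refl | dec-true (b Finₚ.≟ b) refl = refl

sum-pointAt : ∀ {m} (a b : Fin m) c → ∑₂ (pointAt a b c) ≡ c
sum-pointAt {m} a b c = trans (sum-cong-≗ row) (sum-point a c)
  where
  row : ∀ x → ∑[ y < m ] pointAt a b c x y ≡ (if does (x Finₚ.≟ a) then c else 0)
  row x with x Finₚ.≟ a
  ... | yes _ = sum-point b c
  ... | no _  = sum-replicate-zero m

edgeTerm : (G : Graph) → (Fin (n G) → Fin (n G) → ℕ) → Fin (n G) → Fin (n G) → ℕ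
edgeTerm G w x y = if ⌊ toℕ x <? toℕ y ⌋ then (if adj G x y then w x y else 0) else 0

Σedges≡sum : ∀ G w → Σedges G w ≡ ∑₂ (edgeTerm G w)
Σedges≡sum G w = trans (Σfin≡sum (n G) _) (sum-cong-≗ λ x → Σfin≡sum (n G) (edgeTerm G w x))

deg≡sum : ∀ G x → deg G x ≡ ∑[ y < n G ] b2n (adj G x y)
deg≡sum G x = Σfin≡sum (n G) _

edgeTerm-nonadj : ∀ G w {x y} → adj G x y ≡ false → edgeTerm G w x y ≡ 0
edgeTerm-nonadj G w {x} {y} ¬xy rewrite ¬xy with ⌊ toℕ x <? toℕ y ⌋
... | true  = refl
... | false = refl

-- Each edge is counted in exactly one orientation, the one with increasing indices.
edgeTerm-pair : ∀ G w → (∀ x y → w x y ≡ w y x) →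
  ∀ x y → edgeTerm G w x y + edgeTerm G w y x ≡ (if adj G x y then w x y else 0)
edgeTerm-pair G w w-sym x y with toℕ x <? toℕ y | toℕ y <? toℕ x
... | yes x<y | yes y<x = contradiction y<x (<-asym x<y)
... | yes _   | no _    = +-identityʳ _
... | no _    | yes _   rewrite adj-sym G y x | w-sym y x = refl
... | no x≮y  | no y≮x  rewrite toℕ-injective (≤-antisym (≮⇒≥ y≮x) (≮⇒≥ x≮y)) | adj-irrefl G y = refl

b2n≡if : ∀ b → b2n b ≡ (if b then 1 else 0)
b2n≡if true  = refl
b2n≡if false = refl

degreeSum : Graph → ℕ
degreeSum G = ∑[ x < n G ] deg G x

handshake : ∀ G → degreeSum G ≡ 2 * edgeCount G
handshake G = begin
  degreeSum G                          ≡⟨ sum-cong-≗ (deg≡sum G) ⟩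
  ∑₂ (λ x y → b2n (adj G x y))         ≡⟨ sum-cong-≗ (λ x → sum-cong-≗ λ y → trans (b2n≡if _) (sym (pair x y))) ⟩
  ∑₂ (λ x y → e x y + e y x)           ≡⟨ ∑₂-distrib-+ e (λ x y → e y x) ⟩
  ∑₂ e + ∑₂ (λ x y → e y x)            ≡⟨ cong (∑₂ e +_) (∑-comm (λ x y → e y x)) ⟩
  ∑₂ e + ∑₂ e                          ≡⟨ cong (∑₂ e +_) (sym (+-identityʳ (∑₂ e))) ⟩
  2 * ∑₂ e                             ≡⟨ cong (2 *_) (sym (Σedges≡sum G _)) ⟩
  2 * edgeCount G                      ∎
  where
  open ≡-Reasoning
  e = edgeTerm G (λ _ _ → 1)
  pair = edgeTerm-pair G (λ _ _ → 1) (λ _ _ → refl)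

isolate : (G : Graph) → Fin (n G) → Graph
isolate G u = record
  { n      = n G
  ; adj    = λ x y → if touches x y then false else adj G x y
  ; sym    = symmetric
  ; irrefl = λ x → irreflexive x (x Finₚ.≟ u)
  }
  where
  touches : Fin (n G) → Fin (n G) → Bool
  touches x y = does (x Finₚ.≟ u) ∨ does (y Finₚ.≟ u)
  symmetric : ∀ x y → (if touches x y then false else adj G x y) ≡ (if touches y x then false else adj G y x)
  symmetric x y with x Finₚ.≟ u | y Finₚ.≟ u
  ... | yes _ | yes _ = refl
  ... | yes _ | no _  = refl
  ... | no _  | yes _ = refl
  ... | no _  | no _  = adj-sym G x y
  irreflexive : ∀ x (x≟u : Dec (x ≡ u)) → (if does x≟u ∨ does x≟u then false else adj G x x) ≡ false
  irreflexive x (yes _) = refl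
  irreflexive x (no _)  = adj-irrefl G x

isolate-adj-at : ∀ G u y → adj (isolate G u) u y ≡ false
isolate-adj-at G u y rewrite dec-true (u Finₚ.≟ u) refl = refl

isolate-adj-away : ∀ G {u x y} → x ≢ u → y ≢ u → adj (isolate G u) x y ≡ adj G x y
isolate-adj-away G {u} {x} {y} x≢u y≢u rewrite dec-false (x Finₚ.≟ u) x≢u | dec-false (y Finₚ.≟ u) y≢u = refl

isolate-adj⇒adj : ∀ G u {x y} → adj (isolate G u) x y ≡ true → adj G x y ≡ true
isolate-adj⇒adj G u {x} {y} with x Finₚ.≟ u | y Finₚ.≟ u
... | yes _ | _     = λ ()
... | no _  | yes _ = λ ()
... | no _  | no _  = id

isolate-forest : ∀ G u → Forest G → Forest (isolate G u)
isolate-forest G u forest C = forest record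
  { k = k ; f = f ; inj = inj
  ; step = λ i → isolate-adj⇒adj G u (step i) ; close = isolate-adj⇒adj G u close }
  where open Cycle C

b2n-mono : ∀ {a b} → (a ≡ true → b ≡ true) → b2n a ≤ b2n b
b2n-mono {false} a⇒b = z≤n
b2n-mono {true}  a⇒b rewrite a⇒b refl = ≤-refl

deg-isolate-≤ : ∀ G u x → deg (isolate G u) x ≤ deg G x
deg-isolate-≤ G u x = subst₂ _≤_ (sym (deg≡sum (isolate G u) x)) (sym (deg≡sum G x))
  (sum-mono-≤ {n G} λ y → b2n-mono (isolate-adj⇒adj G u))

deg-isolate-at : ∀ G u → deg (isolate G u) u ≡ 0
deg-isolate-at G u = trans (deg≡sum (isolate G u) u) (sum-zero λ y → cong b2n (isolate-adj-at G u y))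

adj⇒deg-positive : ∀ G {u v} → adj G u v ≡ true → 0 < deg G u
adj⇒deg-positive G {u} {v} uv = subst (0 <_) (sym (deg≡sum G u))
  (≤-trans (≤-reflexive (cong b2n (sym uv))) (term≤sum (λ y → b2n (adj G u y)) v))

degreeSum-isolate : ∀ G {u v} → adj G u v ≡ true → degreeSum (isolate G u) < degreeSum G
degreeSum-isolate G {u} uv = sum-mono-< (deg-isolate-≤ G u) u
  (subst (_< deg G u) (sym (deg-isolate-at G u)) (adj⇒deg-positive G uv))

record Leaf (G : Graph) (u v : Fin (n G)) : Set where
  field
    adjacent : adj G u v ≡ true
    unique   : ∀ y → adj G u y ≡ true → y ≡ v

module _ (G : Graph) (w : Fin (n G) → Fin (n G) → ℕ) {u v : Fin (n G)} (leaf : Leaf G u v) where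
  open Leaf leaf

  private
    only-v : ∀ {y} → y ≢ v → adj G u y ≡ false
    only-v {y} y≢v with adj G u y in uy
    ... | true  = contradiction (unique y uy) y≢v
    ... | false = refl

    fromLeaf-≤ : ∀ y → edgeTerm G w u y ≤ pointAt u v (edgeTerm G w u v) u y
    fromLeaf-≤ y = cases (y Finₚ.≟ v)
      where
      cases : Dec (y ≡ v) → edgeTerm G w u y ≤ pointAt u v (edgeTerm G w u v) u y
      cases (yes refl) = ≤-reflexive (sym (pointAt-at u v _))
      cases (no y≢v)   = ≤-trans (≤-reflexive (edgeTerm-nonadj G w (only-v y≢v))) z≤n

    toLeaf-≤ : ∀ x → edgeTerm G w x u ≤ pointAt v u (edgeTerm G w v u) x u
    toLeaf-≤ x = cases (x Finₚ.≟ v)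
      where
      cases : Dec (x ≡ v) → edgeTerm G w x u ≤ pointAt v u (edgeTerm G w v u) x u
      cases (yes refl) = ≤-reflexive (sym (pointAt-at v u _))
      cases (no x≢v)   = ≤-trans (≤-reflexive (edgeTerm-nonadj G w (trans (adj-sym G x u) (only-v x≢v)))) z≤n

  edgeTerm-isolate-leaf : ∀ x y → edgeTerm G w x y ≤
    edgeTerm (isolate G u) w x y + pointAt u v (edgeTerm G w u v) x y + pointAt v u (edgeTerm G w v u) x y
  edgeTerm-isolate-leaf x y = cases (x Finₚ.≟ u) (y Finₚ.≟ u)
    where
    cases : Dec (x ≡ u) → Dec (y ≡ u) → edgeTerm G w x y ≤
      edgeTerm (isolate G u) w x y + pointAt u v (edgeTerm G w u v) x y + pointAt v u (edgeTerm G w v u) x y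
    cases (yes refl) _          = m≤n⇒m≤n+o (pointAt v u (edgeTerm G w v u) u y)
                                    (m≤n⇒m≤o+n (edgeTerm (isolate G u) w u y) (fromLeaf-≤ y))
    cases (no _)     (yes refl) = m≤n⇒m≤o+n (edgeTerm (isolate G u) w x u + pointAt u v (edgeTerm G w u v) x u)
                                    (toLeaf-≤ x)
    cases (no x≢u)   (no y≢u)   = m≤n⇒m≤n+o (pointAt v u (edgeTerm G w v u) x y)
                                    (m≤n⇒m≤n+o (pointAt u v (edgeTerm G w u v) x y) (≤-reflexive
      (cong (λ b → if ⌊ toℕ x <? toℕ y ⌋ then (if b then w x y else 0) else 0) (sym (isolate-adj-away G x≢u y≢u)))))

  Σedges-isolate-leaf : (∀ x y → w x y ≡ w y x) → Σedges G w ≤ Σedges (isolate G u) w + w u v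
  Σedges-isolate-leaf w-sym = begin
    Σedges G w                                       ≡⟨ Σedges≡sum G w ⟩
    ∑₂ (edgeTerm G w)                                ≤⟨ sum-mono-≤ {N} (λ x → sum-mono-≤ {N} (edgeTerm-isolate-leaf x)) ⟩
    ∑₂ (λ x y → e′ x y + P x y + Q x y)              ≡⟨ ∑₂-distrib-+ (λ x y → e′ x y + P x y) Q ⟩
    ∑₂ (λ x y → e′ x y + P x y) + ∑₂ Q               ≡⟨ cong₂ _+_ (∑₂-distrib-+ e′ P) (sum-pointAt v u _) ⟩
    ∑₂ e′ + ∑₂ P + edgeTerm G w v u                  ≡⟨ cong (λ p → ∑₂ e′ + p + edgeTerm G w v u) (sum-pointAt u v _) ⟩
    ∑₂ e′ + edgeTerm G w u v + edgeTerm G w v u      ≡⟨ +-assoc (∑₂ e′) (edgeTerm G w u v) _ ⟩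
    ∑₂ e′ + (edgeTerm G w u v + edgeTerm G w v u)    ≡⟨ cong₂ _+_ (sym (Σedges≡sum (isolate G u) w))
                                                                  (edgeTerm-pair G w w-sym u v) ⟩
    Σedges (isolate G u) w + (if adj G u v then w u v else 0)
      ≡⟨ cong (λ b → Σedges (isolate G u) w + (if b then w u v else 0)) adjacent ⟩
    Σedges (isolate G u) w + w u v                   ∎
    where
    open ≤-Reasoning
    N = n G
    e′ = edgeTerm (isolate G u) w
    P = pointAt u v (edgeTerm G w u v)
    Q = pointAt v u (edgeTerm G w v u)

record Path (G : Graph) (k : ℕ) : Set where
  field
    vertex    : ℕ → Fin (n G)
    injective : ∀ {i j} → i ≤ k → j ≤ k → vertex i ≡ vertex j → i ≡ j
    linked    : ∀ {i} → i < k → adj G (vertex i) (vertex (suc i)) ≡ true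

LeafOtherThan : (G : Graph) → Fin (n G) → Set
LeafOtherThan G r = ∃₂ λ u v → u ≢ r × Leaf G u v

module _ {G : Graph} where
  open Path

  edgePath : ∀ {x y} → adj G x y ≡ true → Path G 1
  edgePath {x} {y} xy = record { vertex = v ; injective = inj ; linked = λ { z<s → xy } }
    where
    v : ℕ → Fin (n G)
    v zero    = x
    v (suc _) = y
    x≢y : x ≢ y
    x≢y refl = contradiction (trans (sym xy) (adj-irrefl G x)) λ ()
    inj : ∀ {i j} → i ≤ 1 → j ≤ 1 → v i ≡ v j → i ≡ j
    inj {zero}  {zero}  _ _ _ = refl
    inj {zero}  {suc _} _ _ x≡y = contradiction x≡y x≢y
    inj {suc _} {zero}  _ _ y≡x = contradiction (sym y≡x) x≢y
    inj {suc _} {suc _} (s≤s z≤n) (s≤s z≤n) _ = refl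

  path-length< : ∀ {k} → Path G k → k < n G
  path-length< {k} P with k <? n G
  ... | yes k<n = k<n
  ... | no k≮n with pigeonhole (s≤s (≮⇒≥ k≮n)) (λ (i : Fin (suc k)) → vertex P (toℕ i))
  ...   | i , j , i<j , same =
    contradiction (injective P (≤-pred (toℕ<n i)) (≤-pred (toℕ<n j)) same) (<⇒≢ i<j)

  -- The vertices j, j+1, …, k of the path together with the chord k—j form a cycle of length k − j + 1 ≥ 3.
  chord⇒cycle : ∀ {k j} (P : Path G k) → j + 2 ≤ k → adj G (vertex P k) (vertex P j) ≡ true → Cycle G
  chord⇒cycle {k} {j} P j+2≤k chord = record
    { k = m ; f = f ; inj = λ {a} {b} → inj a b ; step = step ; close = close }
    where
    m = k ∸ (j + 2)
    k≡ : j + (2 + m) ≡ k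
    k≡ = trans (sym (+-assoc j 2 m)) (m+[n∸m]≡n j+2≤k)
    f : Fin (3 + m) → Fin (n G)
    f i = vertex P (j + toℕ i)
    on-path : ∀ (i : Fin (3 + m)) → j + toℕ i ≤ k
    on-path i = subst (j + toℕ i ≤_) k≡ (+-monoʳ-≤ j (≤-pred (toℕ<n i)))
    inj : ∀ a b → f a ≡ f b → a ≡ b
    inj a b fa≡fb = toℕ-injective (+-cancelˡ-≡ j _ _ (injective P (on-path a) (on-path b) fa≡fb))
    step : ∀ (i : Fin (2 + m)) → adj G (f (inject₁ i)) (f (suc i)) ≡ true
    step i rewrite toℕ-inject₁ i | +-suc j (toℕ i) =
      linked P (subst (j + toℕ i <_) k≡ (+-monoʳ-< j (toℕ<n i)))
    close : adj G (f (fromℕ (2 + m))) (f zero) ≡ true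
    close rewrite toℕ-fromℕ (2 + m) | +-identityʳ j | k≡ = chord

  extendPath : ∀ {k y} (P : Path G k) → adj G (vertex P k) y ≡ true → (∀ {i} → i ≤ k → vertex P i ≢ y) →
               Path G (suc k)
  extendPath {k} {y} P ky fresh = record { vertex = v ; injective = inj ; linked = lnk }
    where
    v : ℕ → Fin (n G)
    v i = if ⌊ i ≤? k ⌋ then vertex P i else y
    old : ∀ {i} → i ≤ k → v i ≡ vertex P i
    old {i} i≤k with i ≤? k
    ... | yes _   = refl
    ... | no i≰k = contradiction i≤k i≰k
    new : v (suc k) ≡ y
    new with suc k ≤? k
    ... | yes k<k = contradiction k<k (<-irrefl refl)
    ... | no _    = refl
    inj : ∀ {i j} → i ≤ suc k → j ≤ suc k → v i ≡ v j → i ≡ j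
    inj {i} {j} i≤ j≤ vi≡vj with m≤n⇒m<n∨m≡n i≤ | m≤n⇒m<n∨m≡n j≤
    ... | inj₁ i<   | inj₁ j<   = injective P (≤-pred i<) (≤-pred j<) (trans (sym (old (≤-pred i<))) (trans vi≡vj (old (≤-pred j<))))
    ... | inj₁ i<   | inj₂ refl = contradiction (trans (sym (old (≤-pred i<))) (trans vi≡vj new)) (fresh (≤-pred i<))
    ... | inj₂ refl | inj₁ j<   = contradiction (trans (sym (old (≤-pred j<))) (trans (sym vi≡vj) new)) (fresh (≤-pred j<))
    ... | inj₂ refl | inj₂ refl = refl
    lnk : ∀ {i} → i < suc k → adj G (v i) (v (suc i)) ≡ true
    lnk {i} (s≤s i≤k) with m≤n⇒m<n∨m≡n i≤k
    ... | inj₁ i<k  rewrite old i≤k | old i<k = linked P i<k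
    ... | inj₂ refl rewrite old i≤k | new     = ky

  -- Either the far end of the path is a leaf, or it has a neighbour off the path (a neighbour on
  -- the path other than its predecessor would close a cycle).
  extendPath-or-leaf : Forest G → ∀ {k} (P : Path G (suc k)) →
    (Σ (Path G (suc (suc k))) λ P′ → vertex P′ 0 ≡ vertex P 0) ⊎ LeafOtherThan G (vertex P 0)
  extendPath-or-leaf forest {k} P with any? (λ y → (adj G (vertex P (suc k)) y Bool.≟ true) ×-dec ¬? (y Finₚ.≟ vertex P k))
  ... | no no-next = inj₂ (vertex P (suc k) , vertex P k , end≢start , record { adjacent = back ; unique = only-prev })
    where
    end≢start : vertex P (suc k) ≢ vertex P 0
    end≢start same = contradiction (injective P ≤-refl z≤n same) λ ()
    back : adj G (vertex P (suc k)) (vertex P k) ≡ true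
    back = trans (adj-sym G _ _) (linked P ≤-refl)
    only-prev : ∀ y → adj G (vertex P (suc k)) y ≡ true → y ≡ vertex P k
    only-prev y next with y Finₚ.≟ vertex P k
    ... | yes y≡prev = y≡prev
    ... | no y≢prev  = contradiction (y , next , y≢prev) no-next
  ... | yes (y , next , y≢prev) with any? (λ (j : Fin (2 + k)) → vertex P (toℕ j) Finₚ.≟ y)
  ...   | no off-path = inj₁ (extendPath P next fresh , refl)
    where
    fresh : ∀ {i} → i ≤ suc k → vertex P i ≢ y
    fresh {i} i≤ vi≡y = off-path (Fin.fromℕ< (s≤s i≤) , subst (λ j → vertex P j ≡ y) (sym (Finₚ.toℕ-fromℕ< (s≤s i≤))) vi≡y)
  ...   | yes (j , vj≡y) with m≤n⇒m<n∨m≡n (≤-pred (toℕ<n j))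
  ...     | inj₂ j≡end = contradiction (trans (sym next) (trans (cong (adj G (vertex P (suc k))) y≡end) (adj-irrefl G _))) λ ()
    where y≡end = trans (sym vj≡y) (cong (vertex P) j≡end)
  ...     | inj₁ j<end with m≤n⇒m<n∨m≡n (≤-pred j<end)
  ...       | inj₂ j≡prev = contradiction (trans (sym vj≡y) (cong (vertex P) j≡prev)) y≢prev
  ...       | inj₁ j<prev = ⊥-elim (forest (chord⇒cycle P (subst (_≤ suc k) (+-comm 2 (toℕ j)) (s≤s j<prev))
                                           (subst (λ z → adj G (vertex P (suc k)) z ≡ true) (sym vj≡y) next)))

  leaf-away-from-start : Forest G → ∀ fuel {k} → n G ≤ k + fuel → (P : Path G (suc k)) → LeafOtherThan G (vertex P 0)
  leaf-away-from-start forest zero       {k} n≤ P =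
    contradiction (≤-trans (<⇒≤ (path-length< P)) (≤-trans n≤ (≤-reflexive (+-identityʳ k)))) 1+n≰n
  leaf-away-from-start forest (suc fuel) {k} n≤ P with extendPath-or-leaf forest P
  ... | inj₂ leaf         = leaf
  ... | inj₁ (P′ , same) = subst (LeafOtherThan G) same (leaf-away-from-start forest fuel (subst (n G ≤_) (+-suc k fuel) n≤) P′)

  edgeless-or-leaf : Forest G → ∀ r → (∀ x y → adj G x y ≡ false) ⊎ LeafOtherThan G r
  edgeless-or-leaf forest r with any? (λ y → adj G r y Bool.≟ true)
  ... | yes (y , ry) = inj₂ (leaf-away-from-start forest (n G) ≤-refl (edgePath ry))
  ... | no r-isolated with any? (λ x → any? (λ y → adj G x y Bool.≟ true))
  ...   | no edgeless = inj₁ λ x y → ¬-not λ xy → edgeless (x , y , xy)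
  ...   | yes (x , y , xy) with leaf-away-from-start forest (n G) ≤-refl (edgePath xy)
  ...     | u , v , _ , leaf = inj₂ (u , v , u≢r , leaf)
    where
    u≢r : u ≢ r
    u≢r refl = r-isolated (v , Leaf.adjacent leaf)

whenPositive : ℕ → ℕ → ℕ
whenPositive zero    a = 0
whenPositive (suc _) a = a

whenPositive-mono : ∀ {d e} a → d ≤ e → whenPositive d a ≤ whenPositive e a
whenPositive-mono {zero}          a _ = z≤n
whenPositive-mono {suc _} {suc _} a _ = ≤-refl

whenPositive-positive : ∀ {d} a → 0 < d → whenPositive d a ≡ a
whenPositive-positive {suc _} a _ = refl

whenPositive-self : ∀ d → whenPositive d d ≡ d
whenPositive-self zero    = refl
whenPositive-self (suc d) = refl

if-else-mono : ∀ c {a b} → a ≤ b → (if c then 0 else a) ≤ (if c then 0 else b)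
if-else-mono true  _   = z≤n
if-else-mono false a≤b = a≤b

activeWeight : (G : Graph) → (Fin (n G) → ℕ) → Fin (n G) → ℕ
activeWeight G w r = ∑[ x < n G ] (if does (x Finₚ.≟ r) then 0 else whenPositive (deg G x) (w x))

activeWeight-isolate : ∀ G w {r u v} → u ≢ r → adj G u v ≡ true →
  activeWeight (isolate G u) w r + w u ≤ activeWeight G w r
activeWeight-isolate G w {r} {u} u≢r uv = begin
  activeWeight (isolate G u) w r + w u                       ≡⟨ cong (activeWeight (isolate G u) w r +_) (sym (sum-point u (w u))) ⟩
  activeWeight (isolate G u) w r + ∑[ x < n G ] point x      ≡⟨ sym (∑-distrib-+ (term (deg (isolate G u))) point) ⟩
  ∑[ x < n G ] (term (deg (isolate G u)) x + point x)              ≤⟨ sum-mono-≤ {n G} (λ x → cases x (x Finₚ.≟ u)) ⟩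
  activeWeight G w r                                         ∎
  where
  open ≤-Reasoning
  term : (Fin (n G) → ℕ) → Fin (n G) → ℕ
  term d x = if does (x Finₚ.≟ r) then 0 else whenPositive (d x) (w x)
  point : Fin (n G) → ℕ
  point x = if does (x Finₚ.≟ u) then w u else 0
  cases : ∀ x → Dec (x ≡ u) → term (deg (isolate G u)) x + point x ≤ term (deg G) x
  cases x (yes refl) = ≤-reflexive (begin-equality
    term (deg (isolate G u)) u + point u
      ≡⟨ cong₂ (λ b c → (if b then 0 else whenPositive (deg (isolate G u) u) (w u)) + (if c then w u else 0))
               (dec-false (u Finₚ.≟ r) u≢r) (dec-true (u Finₚ.≟ u) refl) ⟩
    whenPositive (deg (isolate G u) u) (w u) + w u ≡⟨ cong (λ d → whenPositive d (w u) + w u) (deg-isolate-at G u) ⟩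
    w u                                            ≡⟨ sym (whenPositive-positive (w u) (adj⇒deg-positive G uv)) ⟩
    whenPositive (deg G u) (w u)                   ≡⟨ cong (λ b → if b then 0 else whenPositive (deg G u) (w u))
                                                           (sym (dec-false (u Finₚ.≟ r) u≢r)) ⟩
    term (deg G) u                                 ∎)
  cases x (no x≢u) = begin
    term (deg (isolate G u)) x + point x ≡⟨ cong (λ b → term (deg (isolate G u)) x + (if b then w u else 0))
                                                  (dec-false (x Finₚ.≟ u) x≢u) ⟩
    term (deg (isolate G u)) x + 0       ≡⟨ +-identityʳ _ ⟩
    term (deg (isolate G u)) x           ≤⟨ if-else-mono (does (x Finₚ.≟ r)) (whenPositive-mono (w x) (deg-isolate-≤ G u x)) ⟩
    term (deg G) x                       ∎

Σedges-edgeless : ∀ G w → (∀ x y → adj G x y ≡ false) → Σedges G w ≡ 0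
Σedges-edgeless G w edgeless =
  trans (Σedges≡sum G w) (sum-zero λ x → sum-zero λ y → edgeTerm-nonadj G w (edgeless x y))

Σedges-min≤activeWeight : ∀ G → Forest G → ∀ w r → Σedges G (λ x y → w x ⊓ w y) ≤ activeWeight G w r
Σedges-min≤activeWeight G forest w r = peel G forest w r (<-wellFounded (degreeSum G))
  where
  peel : ∀ G → Forest G → ∀ w r → Acc _<_ (degreeSum G) → Σedges G (λ x y → w x ⊓ w y) ≤ activeWeight G w r
  peel G forest w r (acc smaller) with edgeless-or-leaf forest r
  ... | inj₁ edgeless = ≤-trans (≤-reflexive (Σedges-edgeless G _ edgeless)) z≤n
  ... | inj₂ (u , v , u≢r , leaf) = begin
    Σedges G (λ x y → w x ⊓ w y)                      ≤⟨ Σedges-isolate-leaf G _ leaf (λ x y → ⊓-comm (w x) (w y)) ⟩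
    Σedges (isolate G u) (λ x y → w x ⊓ w y) + w u ⊓ w v
      ≤⟨ +-mono-≤ (peel (isolate G u) (isolate-forest G u forest) w r (smaller (degreeSum-isolate G adjacent)))
                  (m⊓n≤m (w u) (w v)) ⟩
    activeWeight (isolate G u) w r + w u              ≤⟨ activeWeight-isolate G w u≢r adjacent ⟩
    activeWeight G w r                                ∎
    where
    open ≤-Reasoning
    open Leaf leaf

activeWeight-deg : ∀ G r → activeWeight G (deg G) r + deg G r ≡ degreeSum G
activeWeight-deg G r = begin
  activeWeight G (deg G) r + deg G r                            ≡⟨ cong (activeWeight G (deg G) r +_) (sym (sum-point r (deg G r))) ⟩
  activeWeight G (deg G) r + ∑[ x < n G ] point x               ≡⟨ sym (∑-distrib-+ term point) ⟩
  ∑[ x < n G ] (term x + point x)                               ≡⟨ sum-cong-≗ (λ x → cases x (x Finₚ.≟ r)) ⟩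
  degreeSum G                                                   ∎
  where
  open ≡-Reasoning
  term point : Fin (n G) → ℕ
  term x = if does (x Finₚ.≟ r) then 0 else whenPositive (deg G x) (deg G x)
  point x = if does (x Finₚ.≟ r) then deg G r else 0
  cases : ∀ x → Dec (x ≡ r) → term x + point x ≡ deg G x
  cases x (yes refl) rewrite dec-true (r Finₚ.≟ r) refl = refl
  cases x (no x≢r)   rewrite dec-false (x Finₚ.≟ r) x≢r = trans (+-identityʳ _) (whenPositive-self (deg G x))

specialty+deg≤2*edgeCount : ∀ G → Forest G → ∀ r → specialty G + deg G r ≤ 2 * edgeCount G
specialty+deg≤2*edgeCount G forest r = begin
  specialty G + deg G r                    ≤⟨ +-monoˡ-≤ (deg G r) (Σedges-min≤activeWeight G forest (deg G) r) ⟩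
  activeWeight G (deg G) r + deg G r       ≡⟨ activeWeight-deg G r ⟩
  degreeSum G                              ≡⟨ handshake G ⟩
  2 * edgeCount G                          ∎
  where open ≤-Reasoning

guarded-mono : ∀ b c {a a′} → a ≤ a′ → (if b then (if c then a else 0) else 0) ≤ (if b then (if c then a′ else 0) else 0)
guarded-mono true  true  a≤a′ = a≤a′
guarded-mono true  false _    = z≤n
guarded-mono false _     _    = z≤n

guarded-scale : ∀ b c d → (if b then (if c then d else 0) else 0) ≡ d * (if b then (if c then 1 else 0) else 0)
guarded-scale true  true  d = sym (*-identityʳ d)
guarded-scale true  false d = sym (*-zeroʳ d)
guarded-scale false _     d = sym (*-zeroʳ d)

Σedges-mono : ∀ G {w w′} → (∀ x y → w x y ≤ w′ x y) → Σedges G w ≤ Σedges G w′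
Σedges-mono G {w} {w′} w≤w′ = subst₂ _≤_ (sym (Σedges≡sum G w)) (sym (Σedges≡sum G w′))
  (sum-mono-≤ {n G} λ x → sum-mono-≤ {n G} λ y → guarded-mono ⌊ toℕ x <? toℕ y ⌋ (adj G x y) (w≤w′ x y))

Σedges-cong : ∀ G {w w′} → (∀ x y → w x y ≡ w′ x y) → Σedges G w ≡ Σedges G w′
Σedges-cong G {w} {w′} w≡w′ = trans (Σedges≡sum G w) (trans
  (sum-cong-≗ {n G} λ x → sum-cong-≗ {n G} λ y →
    cong (λ a → if ⌊ toℕ x <? toℕ y ⌋ then (if adj G x y then a else 0) else 0) (w≡w′ x y))
  (sym (Σedges≡sum G w′)))

Σedges-const : ∀ G d → Σedges G (λ _ _ → d) ≡ d * edgeCount G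
Σedges-const G d = begin
  Σedges G (λ _ _ → d)                          ≡⟨ Σedges≡sum G _ ⟩
  ∑[ x < n G ] ∑[ y < n G ] edgeTerm G (λ _ _ → d) x y
    ≡⟨ sum-cong-≗ (λ x → sum-cong-≗ λ y → guarded-scale ⌊ toℕ x <? toℕ y ⌋ (adj G x y) d) ⟩
  ∑[ x < n G ] ∑[ y < n G ] (d * e x y)         ≡⟨ sum-cong-≗ (λ x → sym (*-distribˡ-sum d (e x))) ⟩
  ∑[ x < n G ] (d * ∑[ y < n G ] e x y)         ≡⟨ sym (*-distribˡ-sum d (λ x → ∑[ y < n G ] e x y)) ⟩
  d * ∑₂ e                                      ≡⟨ cong (d *_) (sym (Σedges≡sum G _)) ⟩
  d * edgeCount G                               ∎
  where
  open ≡-Reasoning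
  e = edgeTerm G (λ _ _ → 1)

specialty≤maxDeg*edgeCount : ∀ G {d} → (∀ x → deg G x ≤ d) → specialty G ≤ d * edgeCount G
specialty≤maxDeg*edgeCount G {d} deg≤d =
  ≤-trans (Σedges-mono G (λ x y → ≤-trans (m⊓n≤m _ _) (deg≤d x))) (≤-reflexive (Σedges-const G d))

N≤maxSpecialty : ∀ {N} → 1 ≤ N → N ≤ maxSpecialty N
N≤maxSpecialty {suc zero}    _ = ≤-refl
N≤maxSpecialty {suc (suc K)} _ = ≤-trans (≤-reflexive (cong (λ m → suc (suc m)) (sym (+-identityʳ K)))) (m≤n+m (suc (suc (K + 0))) K)

2*N∸2≤maxSpecialty : ∀ N → 2 * N ∸ 2 ≤ maxSpecialty N
2*N∸2≤maxSpecialty zero          = z≤n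
2*N∸2≤maxSpecialty (suc zero)    = z≤n
2*N∸2≤maxSpecialty (suc (suc K)) = ≤-refl

maxSpecialty-bound : ∀ {N S} d → 1 ≤ N → S ≤ d * N → S + d ≤ 2 * N → S ≤ maxSpecialty N
maxSpecialty-bound zero          _   S≤0  _ = ≤-trans S≤0 z≤n
maxSpecialty-bound {N} (suc zero) 1≤N S≤N _ = ≤-trans S≤N (≤-trans (≤-reflexive (+-identityʳ N)) (N≤maxSpecialty 1≤N))
maxSpecialty-bound {N} {S} (suc (suc d)) _ _ S+d≤2N =
  ≤-trans (m+n≤o⇒m≤o∸n S S+d≤2N) (≤-trans (∸-monoʳ-≤ (2 * N) (s≤s (s≤s z≤n))) (2*N∸2≤maxSpecialty N))

specialty≤maxSpecialty : ∀ G → Forest G → 1 ≤ edgeCount G → specialty G ≤ maxSpecialty (edgeCount G)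
specialty≤maxSpecialty G forest 1≤E with sum-positive (λ x → ∑[ y < n G ] edgeTerm G (λ _ _ → 1) x y)
                                                     (subst (0 <_) (Σedges≡sum G _) 1≤E)
... | x , _ with maximum-attained (deg G) x
...   | r , maxDeg = maxSpecialty-bound (deg G r) 1≤E (specialty≤maxDeg*edgeCount G maxDeg)
                                         (specialty+deg≤2*edgeCount G forest r)

module _ {G : Graph} (C : Cycle G) where
  open Cycle C

  cycle-neighbours : ∀ i → ∃₂ λ a b → a ≢ b × adj G (f i) (f a) ≡ true × adj G (f i) (f b) ≡ true
  cycle-neighbours zero = suc zero , fromℕ (2 + k) , (λ ()) , step zero , trans (adj-sym G _ _) close
  cycle-neighbours (suc j) with view j
  ... | ‵fromℕ      = inject₁ j , zero , (λ ()) , trans (adj-sym G _ _) (step j) , close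
  ... | ‵inject₁ j′ = inject₁ j , suc (suc j′) , apart , trans (adj-sym G _ _) (step j) , step (suc j′)
    where
    apart : inject₁ (inject₁ j′) ≢ suc (suc j′)
    apart same = contradiction (trans (sym (trans (toℕ-inject₁ _) (toℕ-inject₁ j′))) (cong toℕ same))
                               (<⇒≢ (s≤s (n≤1+n (toℕ j′))))

consecutive : ℕ → ℕ → Bool
consecutive i j = does (suc i ≟ j) ∨ does (suc j ≟ i)

pathGraph : ℕ → Graph
pathGraph N = record
  { n      = suc N
  ; adj    = λ x y → consecutive (toℕ x) (toℕ y)
  ; sym    = λ x y → Bool.∨-comm (does (suc (toℕ x) ≟ toℕ y)) _
  ; irrefl = λ x → cong (λ b → b ∨ b) (dec-false (suc (toℕ x) ≟ toℕ x) 1+n≢n)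
  }

consecutive⇒ : ∀ {i j} → consecutive i j ≡ true → suc i ≡ j ⊎ suc j ≡ i
consecutive⇒ {i} {j} = cases (suc i ≟ j) (suc j ≟ i)
  where
  cases : (p : Dec (suc i ≡ j)) (q : Dec (suc j ≡ i)) → does p ∨ does q ≡ true → suc i ≡ j ⊎ suc j ≡ i
  cases (yes i+1≡j) _           _  = inj₁ i+1≡j
  cases (no _)      (yes j+1≡i) _  = inj₂ j+1≡i
  cases (no _)      (no _)      ()

-- A vertex of largest label on a cycle would have two distinct cycle neighbours, both labelled one less.
pathGraph-forest : ∀ N → Forest (pathGraph N)
pathGraph-forest N C with maximum-attained (toℕ ∘ f) zero
  where open Cycle C
... | i , top with cycle-neighbours C i
... | a , b , a≢b , ia , ib = a≢b (inj (toℕ-injective (suc-injective (trans (below ia) (sym (below ib))))))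
  where
  open Cycle C
  below : ∀ {c} → consecutive (toℕ (f i)) (toℕ (f c)) ≡ true → suc (toℕ (f c)) ≡ toℕ (f i)
  below {c} ic with consecutive⇒ ic
  ... | inj₂ c+1≡i = c+1≡i
  ... | inj₁ i+1≡c = contradiction (subst (_≤ toℕ (f i)) (sym i+1≡c) (top c)) 1+n≰n

edgeTerm-pathGraph : ∀ N (W : ℕ → ℕ → ℕ) x y → edgeTerm (pathGraph N) (λ x y → W (toℕ x) (toℕ y)) x y
                                 ≡ (if does (suc (toℕ x) ≟ toℕ y) then W (toℕ x) (toℕ y) else 0)
edgeTerm-pathGraph N W x y = cases (toℕ x <? toℕ y) (suc (toℕ x) ≟ toℕ y) (suc (toℕ y) ≟ toℕ x)
  where
  cases : ∀ {i j} (lt : Dec (i < j)) (up : Dec (suc i ≡ j)) (down : Dec (suc j ≡ i)) →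
          (if ⌊ lt ⌋ then (if does up ∨ does down then W i j else 0) else 0) ≡ (if does up then W i j else 0)
  cases (yes _)   (yes _)    _          = refl
  cases (no i≮j)  (yes refl) _          = contradiction ≤-refl i≮j
  cases {j = j} (yes i<j) (no _) (yes refl) = contradiction i<j (<-asym (n<1+n j))
  cases (yes _)   (no _)     (no _)     = refl
  cases (no _)    (no _)     _          = refl

Σedges-pathGraph : ∀ N (W : ℕ → ℕ → ℕ) → Σedges (pathGraph N) (λ x y → W (toℕ x) (toℕ y)) ≡ ∑[ i < N ] W (toℕ i) (suc (toℕ i))
Σedges-pathGraph N W = begin
  Σedges (pathGraph N) (λ x y → W (toℕ x) (toℕ y))
    ≡⟨ Σedges≡sum (pathGraph N) _ ⟩
  ∑₂ (edgeTerm (pathGraph N) (λ x y → W (toℕ x) (toℕ y)))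
    ≡⟨ sum-cong-≗ (λ x → trans (sum-cong-≗ (edgeTerm-pathGraph N W x)) (sum-toℕ-point (suc N) (suc (toℕ x)) (W (toℕ x)))) ⟩
  ∑[ x < suc N ] (if does (toℕ x <? N) then W (toℕ x) (suc (toℕ x)) else 0)
    ≡⟨ sum-toℕ-below N (λ i → W i (suc i)) ⟩
  ∑[ i < N ] W (toℕ i) (suc (toℕ i)) ∎
  where open ≡-Reasoning

pathDegree : ℕ → ℕ → ℕ
pathDegree N i = b2n (does (i <? N)) + b2n (does (0 <? i))

b2n-consecutive : ∀ i j → b2n (consecutive i j) ≡ b2n (does (suc i ≟ j)) + b2n (does (suc j ≟ i))
b2n-consecutive i j = cases (suc i ≟ j) (suc j ≟ i)
  where
  cases : ∀ {i j} (up : Dec (suc i ≡ j)) (down : Dec (suc j ≡ i)) → b2n (does up ∨ does down) ≡ b2n (does up) + b2n (does down)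
  cases {i} (yes refl) (yes i≡2+i) = contradiction i≡2+i (<⇒≢ (≤-trans (n<1+n i) (n≤1+n _)) ∘ sym)
  cases     (yes _)    (no _)      = refl
  cases     (no _)     (yes _)     = refl
  cases     (no _)     (no _)      = refl

deg-pathGraph : ∀ N x → deg (pathGraph N) x ≡ pathDegree N (toℕ x)
deg-pathGraph N x = begin
  deg (pathGraph N) x                                        ≡⟨ deg≡sum (pathGraph N) x ⟩
  ∑[ y < suc N ] b2n (consecutive (toℕ x) (toℕ y))           ≡⟨ sum-cong-≗ {suc N} (λ y → b2n-consecutive (toℕ x) (toℕ y)) ⟩
  ∑[ y < suc N ] (b2n (does (suc (toℕ x) ≟ toℕ y)) + b2n (does (suc (toℕ y) ≟ toℕ x)))
    ≡⟨ ∑-distrib-+ {suc N} (λ y → b2n (does (suc (toℕ x) ≟ toℕ y))) (λ y → b2n (does (suc (toℕ y) ≟ toℕ x))) ⟩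
  ∑[ y < suc N ] b2n (does (suc (toℕ x) ≟ toℕ y)) + ∑[ y < suc N ] b2n (does (suc (toℕ y) ≟ toℕ x))
    ≡⟨ cong₂ _+_ (successor (suc (toℕ x))) (predecessor (toℕ x) (≤-pred (toℕ<n x))) ⟩
  pathDegree N (toℕ x)                                       ∎
  where
  open ≡-Reasoning
  successor : ∀ a → ∑[ y < suc N ] b2n (does (a ≟ toℕ y)) ≡ b2n (does (a <? suc N))
  successor a = trans (sum-cong-≗ {suc N} (λ y → b2n≡if (does (a ≟ toℕ y))))
                      (trans (sum-toℕ-point (suc N) a (λ _ → 1)) (sym (b2n≡if (does (a <? suc N)))))
  predecessor : ∀ i → i ≤ N → ∑[ y < suc N ] b2n (does (suc (toℕ y) ≟ i)) ≡ b2n (does (0 <? i))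
  predecessor zero    _   = sum-replicate-zero (suc N)
  predecessor (suc i) i<N = begin
    ∑[ y < suc N ] b2n (does (toℕ y ≟ i))                    ≡⟨ sum-cong-≗ {suc N} (λ y → cong b2n (does-≟-sym (toℕ y) i)) ⟩
    ∑[ y < suc N ] b2n (does (i ≟ toℕ y))                    ≡⟨ successor i ⟩
    b2n (does (i <? suc N))                                  ≡⟨ cong b2n (dec-true (i <? suc N) (≤-trans (n≤1+n _) (s≤s i<N))) ⟩
    1                                                        ∎

specialty-pathGraph : ∀ N → specialty (pathGraph N) ≡ ∑[ i < N ] (pathDegree N (toℕ i) ⊓ pathDegree N (suc (toℕ i)))
specialty-pathGraph N = trans (Σedges-cong (pathGraph N) (λ x y → cong₂ _⊓_ (deg-pathGraph N x) (deg-pathGraph N y)))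
                              (Σedges-pathGraph N (λ i j → pathDegree N i ⊓ pathDegree N j))

-- Both end edges contribute 1, the K interior edges 2 each.
specialty-pathGraph-value : ∀ K → specialty (pathGraph (2 + K)) ≡ maxSpecialty (2 + K)
specialty-pathGraph-value K = begin
  specialty (pathGraph N)                                                ≡⟨ specialty-pathGraph N ⟩
  c 0 + ∑[ i < suc K ] c (suc (toℕ i))                                   ≡⟨ cong (c 0 +_) (sum-init-last {K} (λ i → c (suc (toℕ i)))) ⟩
  1 + (∑[ i < K ] c (suc (toℕ (inject₁ i))) + c (suc (toℕ (fromℕ K))))
    ≡⟨ cong₂ (λ a b → 1 + (a + b)) (sum-cong-≗ {K} (λ i → interior (toℕ (inject₁ i)) (subst (_< K) (sym (toℕ-inject₁ i)) (toℕ<n i))))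
                                   (trans (cong (c ∘ suc) (toℕ-fromℕ K)) end) ⟩
  1 + (∑[ i < K ] 2 + 1)                                                 ≡⟨ cong (λ a → 1 + (a + 1)) (sum-const K 2) ⟩
  1 + (K * 2 + 1)                                                        ≡⟨ arithmetic K ⟩
  maxSpecialty N                                                         ∎
  where
  open ≡-Reasoning
  N = 2 + K
  c : ℕ → ℕ
  c i = pathDegree N i ⊓ pathDegree N (suc i)
  interior : ∀ t → t < K → c (suc t) ≡ 2
  interior t t<K = cong₂ (λ a b → (b2n a + 1) ⊓ (b2n b + 1))
    (dec-true (suc t <? N) (≤-trans (s≤s t<K) (n≤1+n _))) (dec-true (suc (suc t) <? N) (s≤s (s≤s t<K)))
  end : c (suc K) ≡ 1
  end = cong₂ (λ a b → (b2n a + 1) ⊓ (b2n b + 1)) (dec-true (suc K <? N) ≤-refl) (dec-false (N <? N) (<-irrefl refl))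
  arithmetic : ∀ K → 1 + (K * 2 + 1) ≡ K + (2 + K + 0)
  arithmetic = solve-∀

edgeCount-pathGraph : ∀ N → edgeCount (pathGraph N) ≡ N
edgeCount-pathGraph N = trans (Σedges-pathGraph N (λ _ _ → 1)) (trans (sum-const N 1) (*-identityʳ N))

specialty-pathGraph-max : ∀ N → N ≥ 1 → specialty (pathGraph N) ≡ maxSpecialty N
specialty-pathGraph-max (suc zero)    _ = refl
specialty-pathGraph-max (suc (suc K)) _ = specialty-pathGraph-value K

theorem3 : (N : ℕ) → N ≥ 1 →
    (Σ Graph (λ G → Forest G × edgeCount G ≡ N × specialty G ≡ maxSpecialty N))
    × ((G : Graph) → Forest G → edgeCount G ≡ N → specialty G ≤ maxSpecialty N)
theorem3 N N≥1 =
  (pathGraph N , pathGraph-forest N , edgeCount-pathGraph N , specialty-pathGraph-max N N≥1) ,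
  λ G forest edges≡N → subst (λ m → specialty G ≤ maxSpecialty m) edges≡N
                             (specialty≤maxSpecialty G forest (subst (1 ≤_) (sym edges≡N) N≥1))
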